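{- Let $(G_1,\sigma_1,\prec_1)$ and $(G_2,\sigma_2,\prec_2)$ be admissible UPO-graphs such that $G_1$ has $n$ output edges $o_1\prec_1\cdots\prec_1 o_n$ and $G_2$ has $n$ input edges $i_1\prec_2\cdots\prec_2 i_n$, and let $G=G_2\circ G_1$ with composed linear order $\prec=\prec_2\circ\prec_1$. Then for all edges $e_1,e_2$ of $G$, $e_1\to e_2$ in $G$ implies $e_1\prec e_2$.
   Context: Directed graphs are finite, may have multiple edges, and each edge $e$ has source $s(e)$ and target $t(e)$. $I(v)$, $O(v)$ denote the incoming and outgoing edges of a vertex $v$, and $E(v)=I(v)\cup O(v)$. $e_1\to e_2$ means there is a directed path starting with edge $e_1$ and ending with edge $e_2$. For a subset $X$ of a finite linearly ordered set, $\overline{X}$ is the set of elements between $\min X$ and $\max X$ inclusive. An upward planar order on a finite acyclic directed graph $G$ is a linear order $\prec$ on $E(G)$ such that (i) $e_1\to e_2$ implies $e_1\prec e_2$; (ii) for every vertex $v$, $\overline{I(v)}\cap\overline{O(v)}=\emptyset$ and $\overline{E(v)}=\overline{I(v)}\sqcup\overline{O(v)}$; (iii) for any vertices $v_1,v_2$, $I(v_1)\cap\overline{I(v_2)}\neq\emptyset$ implies $\overline{I(v_1)}\subseteq\overline{I(v_2)}$, and $O(v_1)\cap\overline{O(v_2)}\neq\emptyset$ implies $\overline{O(v_1)}\subseteq\overline{O(v_2)}$. A progressive graph $(G,\sigma)$ is a finite acyclic directed graph $G$ with a distinguished subset $\sigma$ of vertices of degree one (boundary vertices); the other vertices are inner vertices.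 Boundary sources are input vertices, boundary sinks are output vertices. Edges starting at a boundary vertex are input edges, forming $I(G)$; edges ending at a boundary vertex are output edges, forming $O(G)$. An upward planar order $\prec$ on $(G,\sigma)$ is admissible if for every inner vertex $v$, $I(G)\cap\overline{O(v)}=\emptyset$ and $O(G)\cap\overline{I(v)}=\emptyset$; $(G,\sigma,\prec)$ is then an admissible UPO-graph. Composition: given $(G_1,\sigma_1,\prec_1)$ with output edges $o_1\prec_1\cdots\prec_1 o_n$ and $(G_2,\sigma_2,\prec_2)$ with input edges $i_1\prec_2\cdots\prec_2 i_n$, the graph $G=G_2\circ G_1$ is obtained by deleting the output vertices of $G_1$ and the input vertices of $G_2$ and, for each $k$, replacing $o_k$ and $i_k$ by a single edge $\overline{e_k}$ with source $s(o_k)$ and target $t(i_k)$; its boundary $\sigma$ consists of the input vertices of $G_1$ and the output vertices of $G_2$. Write $(E(G_1),\prec_1)$ as the consecutive blocks $Q_1,\{o_1\},Q_2,\{o_2\},\dots,Q_n,\{o_n\},Q_{n+1}$ (so $Q_1$ is the set of edges before $o_1$, $Q_k$ those strictly between $o_{k-1}$ and $o_k$, $Q_{n+1}$ those after $o_n$), and $(E(G_2),\prec_2)$ as $P_0,\{i_1\},P_1,\dots,\{i_n\},P_n$ similarly. The composed order $\prec=\prec_2\circ\prec_1$ on $E(G)$ is the linear order whose consecutive blocks are $P_0,Q_1,\{\overline{e_1}\},P_1,Q_2,\{\overline{e_2}\},P_2,\dots,Q_n,\{\overline{e_n}\},P_n,Q_{n+1}$, with each $Q_k$ ordered by $\prec_1$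 and each $P_k$ by $\prec_2$. -}

module Defs where

open import Data.Nat using (ℕ; suc; _<_; _≤_; _*_)
open import Data.Fin using (Fin; toℕ)
open import Data.Bool using (Bool; true; false)
open import Data.Product using (Σ; _×_; _,_; proj₁; proj₂; Σ-syntax)
open import Data.Sum using (_⊎_)
open import Data.Empty using (⊥)
open import Relation.Nullary using (¬_)
open import Relation.Binary.PropositionalEquality using (_≡_; _≢_; refl; sym; trans)
open import Relation.Binary.Structures using (IsStrictTotalOrder)
open import Function.Bundles using (_↔_)

Finite : Set → Set
Finite A = Σ[ m ∈ ℕ ] (A ↔ Fin m)

record Graph : Set₁ where
  field
    V E : Set
    src tgt : E → V

module GraphNotions (G : Graph) where
  open Graph G

  -- e₁ ⇝ e₂ : a directed path (e₁ , … , e₂) of at least two edges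
  -- starting with e₁ and ending with e₂ (consecutive edges composable).
  data _⇝_ : E → E → Set where
    step : ∀ {e₁ e₂} → tgt e₁ ≡ src e₂ → e₁ ⇝ e₂
    cons : ∀ {e₁ e₂ e₃} → tgt e₁ ≡ src e₂ → e₂ ⇝ e₃ → e₁ ⇝ e₃

  Acyclic : Set
  Acyclic = (∀ e → tgt e ≢ src e) × (∀ e → ¬ (e ⇝ e))

  -- I(v), O(v), E(v) as predicates on edges
  I O Inc : V → E → Set
  I v e = tgt e ≡ v
  O v e = src e ≡ v
  Inc v e = I v e ⊎ O v e

  DegreeOne : V → Set
  DegreeOne v = Σ[ e ∈ E ] (Inc v e × (∀ e' → Inc v e' → e' ≡ e))

module OrderNotions {E : Set} (_≺_ : E → E → Set) where
  _≼_ : E → E → Set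
  x ≼ y = x ≺ y ⊎ x ≡ y

  Hull : (E → Set) → E → Set
  Hull X x = Σ[ a ∈ E ] Σ[ b ∈ E ] (X a × X b × a ≼ x × x ≼ b)

module _ (G : Graph) where
  open Graph G
  open GraphNotions G

  record IsUPO (_≺_ : E → E → Set) : Set where
    open OrderNotions _≺_
    field
      linear    : IsStrictTotalOrder _≡_ _≺_
      pathOrder : ∀ e₁ e₂ → e₁ ⇝ e₂ → e₁ ≺ e₂
      disjoint  : ∀ v x → Hull (I v) x → ¬ Hull (O v) x
      cover     : ∀ v x → Hull (Inc v) x → Hull (I v) x ⊎ Hull (O v) x
      cover'    : ∀ v x → Hull (I v) x ⊎ Hull (O v) x → Hull (Inc v) x
      nestI     : ∀ v₁ v₂ → (Σ[ e ∈ E ] (I v₁ e × Hull (I v₂) e)) →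
                  ∀ x → Hull (I v₁) x → Hull (I v₂) x
      nestO     : ∀ v₁ v₂ → (Σ[ e ∈ E ] (O v₁ e × Hull (O v₂) e)) →
                  ∀ x → Hull (O v₁) x → Hull (O v₂) x

  -- boundary given by σ : V → Bool (σ v ≡ true : v is a boundary vertex)
  InputEdge OutputEdge : (V → Bool) → E → Set
  InputEdge σ e = σ (src e) ≡ true
  OutputEdge σ e = σ (tgt e) ≡ true

  record AdmUPO (σ : V → Bool) (_≺_ : E → E → Set) : Set where
    open OrderNotions _≺_
    field
      finiteV    : Finite V
      finiteE    : Finite E
      acyclic    : Acyclic
      boundary   : ∀ v → σ v ≡ true → DegreeOne v
      upo        : IsUPO _≺_
      admissible : ∀ v → σ v ≡ false →
                   (∀ e → InputEdge σ e → ¬ Hull (O v) e) ×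
                   (∀ e → OutputEdge σ e → ¬ Hull (I v) e)

  OrderedEnumeration : (_≺_ : E → E → Set) (P : E → Set) (n : ℕ) → (Fin n → E) → Set
  OrderedEnumeration _≺_ P n f =
    (∀ j → P (f j)) × (∀ e → P e → Σ[ j ∈ Fin n ] f j ≡ e) ×
    (∀ j k → toℕ j < toℕ k → f j ≺ f k)

private
  false≢true : false ≢ true
  false≢true ()

module Composition (G₁ G₂ : Graph)
                   (σ₁ : Graph.V G₁ → Bool) (σ₂ : Graph.V G₂ → Bool)
                   (_≺₁_ : Graph.E G₁ → Graph.E G₁ → Set)
                   (_≺₂_ : Graph.E G₂ → Graph.E G₂ → Set)
                   (n : ℕ) (o : Fin n → Graph.E G₁) (i : Fin n → Graph.E G₂) where
  private
    module G₁ = Graph G₁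
    module G₂ = Graph G₂

  IsOutputVertex₁ : G₁.V → Set
  IsOutputVertex₁ v = σ₁ v ≡ true × (∀ e → G₁.src e ≢ v)

  IsInputVertex₂ : G₂.V → Set
  IsInputVertex₂ v = σ₂ v ≡ true × (∀ e → G₂.tgt e ≢ v)

  data CVertex : Set where
    left  : (v : G₁.V) → .(¬ IsOutputVertex₁ v) → CVertex
    right : (v : G₂.V) → .(¬ IsInputVertex₂ v) → CVertex

  data CEdge : Set where
    left  : (e : G₁.E) → .(σ₁ (G₁.tgt e) ≡ false) → CEdge
    right : (e : G₂.E) → .(σ₂ (G₂.src e) ≡ false) → CEdge
    glued : Fin n → CEdge

  csrc : CEdge → CVertex
  csrc (left e p)  = left (G₁.src e) (λ q → proj₂ q e refl)
  csrc (right e p) = right (G₂.src e) (λ q → false≢true (trans (sym p) (proj₁ q)))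
  csrc (glued j)   = left (G₁.src (o j)) (λ q → proj₂ q (o j) refl)

  ctgt : CEdge → CVertex
  ctgt (left e p)  = left (G₁.tgt e) (λ q → false≢true (trans (sym p) (proj₁ q)))
  ctgt (right e p) = right (G₂.tgt e) (λ q → proj₂ q e refl)
  ctgt (glued j)   = right (G₂.tgt (i j)) (λ q → proj₂ q (i j) refl)

  G : Graph
  G = record { V = CVertex ; E = CEdge ; src = csrc ; tgt = ctgt }

  -- Block numbering of P₀,Q₁,{ē₁},P₁,Q₂,{ē₂},…,Qₙ,{ēₙ},Pₙ,Qₙ₊₁ :
  -- P_b ↦ 3b,  Q_(a+1) ↦ 3a+1,  ē_(j+1) ↦ 3j+2   (o, i are 0-indexed here)
  data InBlock : CEdge → ℕ → Set where
    inQ : ∀ {e} .{p} (a : ℕ) → a ≤ n →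
          (∀ j → toℕ j < a → o j ≺₁ e) → (∀ j → a ≤ toℕ j → e ≺₁ o j) →
          InBlock (left e p) (suc (3 * a))
    inP : ∀ {e} .{p} (b : ℕ) → b ≤ n →
          (∀ j → toℕ j < b → i j ≺₂ e) → (∀ j → b ≤ toℕ j → e ≺₂ i j) →
          InBlock (right e p) (3 * b)
    inE : ∀ j → InBlock (glued j) (suc (suc (3 * toℕ j)))

  WithinBlock : CEdge → CEdge → Set
  WithinBlock (left e _)  (left e' _)  = e ≺₁ e'
  WithinBlock (right e _) (right e' _) = e ≺₂ e'
  WithinBlock _ _ = ⊥

  _≺_ : CEdge → CEdge → Set
  x ≺ y = Σ[ b ∈ ℕ ] Σ[ b' ∈ ℕ ]
            (InBlock x b × InBlock y b' × (b < b' ⊎ (b ≡ b' × WithinBlock x y)))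

-- A path in G₂ ∘ G₁ consists of G₁-edges, then at most one glued edge ē_k, then
-- G₂-edges: no edge leaves a G₂-vertex towards G₁. An edge of G₁ (resp. G₂) lies in
-- block Q_(a+1) (resp. P_a), where a is the number of output edges o_k (resp. input
-- edges i_k) preceding it, and this count is monotone in ≺₁ (resp. ≺₂). Hence a path
-- inside G₁ or inside G₂ is ordered correctly, and a path through ē_k starts in some
-- Q_a with a ≤ k and ends in some P_b with b ≥ k.
module Submission where

open import Defs
open import Data.Nat using (ℕ; zero; suc; _+_; _<_; _≤_; _*_; z≤n; s≤s)
open import Data.Nat.Properties using (*-monoʳ-≤; *-suc; <⇒≤; m≤n⇒m<n∨m≡n; ≤-trans; ≤-reflexive; ≮⇒≥; ≰⇒>)
open import Data.Fin using (Fin; toℕ; fromℕ<) renaming (zero to fzero; suc to fsuc)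
open import Data.Fin.Properties using (toℕ-fromℕ<)
open import Data.Bool using (Bool; false)
open import Data.Bool.Properties using (not-¬)
open import Data.Product using (Σ; _×_; _,_; proj₁; proj₂; Σ-syntax)
open import Data.Sum using (inj₁; inj₂)
open import Data.Empty using (⊥; ⊥-elim)
open import Data.Unit using (⊤; tt)
open import Function using (_∘_)
open import Relation.Nullary.Negation using (contradiction-irr)
open import Relation.Binary.PropositionalEquality using (_≡_; _≢_; refl; sym; subst)
open import Relation.Binary.Structures using (IsStrictTotalOrder)
open import Relation.Binary.Definitions using (tri<; tri≈; tri>)

module Slots {E : Set} {_⊏_ : E → E → Set} (linear : IsStrictTotalOrder _≡_ _⊏_) where
  open IsStrictTotalOrder linear using (compare; asym) renaming (trans to ⊏-trans)

  StrictlyIncreasing : ∀ {n} → (Fin n → E) → Set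
  StrictlyIncreasing o = ∀ j k → toℕ j < toℕ k → o j ⊏ o k

  record Slot {n : ℕ} (o : Fin n → E) (e : E) (a : ℕ) : Set where
    field
      bounded : a ≤ n
      below   : ∀ j → toℕ j < a → o j ⊏ e
      above   : ∀ j → a ≤ toℕ j → e ⊏ o j
  open Slot public

  slot : ∀ {n} (o : Fin n → E) → StrictlyIncreasing o →
         ∀ e → (∀ j → o j ≢ e) → Σ ℕ (Slot o e)
  slot {zero} o _ e _ = 0 , record { bounded = z≤n ; below = λ _ () ; above = λ () }
  slot {suc n} o inc e o≢e with compare e (o fzero)
  ... | tri< e⊏o₀ _ _ = 0 , record { bounded = z≤n ; below = λ _ () ; above = above₀ }
    where
    above₀ : ∀ j → 0 ≤ toℕ j → e ⊏ o j
    above₀ fzero    _ = e⊏o₀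
    above₀ (fsuc k) _ = ⊏-trans e⊏o₀ (inc fzero (fsuc k) (s≤s z≤n))
  ... | tri≈ _ e≡o₀ _ = ⊥-elim (o≢e fzero (sym e≡o₀))
  ... | tri> _ _ o₀⊏e with slot (o ∘ fsuc) (λ j k → inc (fsuc j) (fsuc k) ∘ s≤s) e (o≢e ∘ fsuc)
  ...   | a , s = suc a , record { bounded = s≤s (bounded s) ; below = below′ ; above = above′ }
    where
    below′ : ∀ j → toℕ j < suc a → o j ⊏ e
    below′ fzero    _         = o₀⊏e
    below′ (fsuc k) (s≤s k<a) = below s k k<a
    above′ : ∀ j → suc a ≤ toℕ j → e ⊏ o j
    above′ (fsuc k) (s≤s a≤k) = above s k a≤k

  module _ {n} {o : Fin n → E} where
    slot-≤ : ∀ {e a j} → Slot o e a → e ⊏ o j → a ≤ toℕ j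
    slot-≤ s e⊏oj = ≮⇒≥ (λ j<a → asym e⊏oj (below s _ j<a))

    slot-> : ∀ {e a j} → Slot o e a → o j ⊏ e → toℕ j < a
    slot-> s oj⊏e = ≰⇒> (λ a≤j → asym oj⊏e (above s _ a≤j))

    slot-mono : ∀ {e₁ e₂ a₁ a₂} → Slot o e₁ a₁ → Slot o e₂ a₂ → e₁ ⊏ e₂ → a₁ ≤ a₂
    slot-mono {a₁ = a₁} {a₂} s₁ s₂ e₁⊏e₂ = ≮⇒≥ λ a₂<a₁ →
      let a₂<n = ≤-trans a₂<a₁ (bounded s₁)
          j    = fromℕ< a₂<n
          j≡a₂ = toℕ-fromℕ< a₂<n
      in asym e₁⊏e₂ (⊏-trans (above s₂ j (≤-reflexive (sym j≡a₂)))
                             (below s₁ j (subst (_< a₁) (sym j≡a₂) a₂<a₁)))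

m<n⇒3m+3≤3n : ∀ {m k} → m < k → 3 + 3 * m ≤ 3 * k
m<n⇒3m+3≤3n {m} {k} m<k = subst (_≤ 3 * k) (*-suc 3 m) (*-monoʳ-≤ 3 m<k)

module Composite (G₁ G₂ : Graph) (σ₁ : Graph.V G₁ → Bool) (σ₂ : Graph.V G₂ → Bool)
    (_≺₁_ : Graph.E G₁ → Graph.E G₁ → Set) (_≺₂_ : Graph.E G₂ → Graph.E G₂ → Set)
    (n : ℕ) (o : Fin n → Graph.E G₁) (i : Fin n → Graph.E G₂) where
  open Composition G₁ G₂ σ₁ σ₂ _≺₁_ _≺₂_ n o i
  open GraphNotions G using (_⇝_; step; cons)
  open GraphNotions G₁ using () renaming (_⇝_ to _⇝₁_; step to step₁; cons to cons₁)
  open GraphNotions G₂ using () renaming (_⇝_ to _⇝₂_; step to step₂; cons to cons₂)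

  left-injective : ∀ {v w} .{p q} → CVertex.left v p ≡ CVertex.left w q → v ≡ w
  left-injective refl = refl

  right-injective : ∀ {v w} .{p q} → CVertex.right v p ≡ CVertex.right w q → v ≡ w
  right-injective refl = refl

  IsRight : CVertex → Set
  IsRight (left _ _)  = ⊥
  IsRight (right _ _) = ⊤

  right-source⇒right-target : ∀ x → IsRight (csrc x) → IsRight (ctgt x)
  right-source⇒right-target (right _ _) _ = tt

  ⇝-stays-right : ∀ {x y} → IsRight (ctgt x) → x ⇝ y → IsRight (csrc y)
  ⇝-stays-right isRight (step eq)            = subst IsRight eq isRight
  ⇝-stays-right isRight (cons {e₂ = x} eq r) =
    ⇝-stays-right (right-source⇒right-target x (subst IsRight eq isRight)) r

  ⇝-left-left : ∀ {e₁ e₂} .{p q} → left e₁ p ⇝ left e₂ q → e₁ ⇝₁ e₂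
  ⇝-left-left (step eq)                    = step₁ (left-injective eq)
  ⇝-left-left (cons {e₂ = left _ _} eq r)  = cons₁ (left-injective eq) (⇝-left-left r)
  ⇝-left-left (cons {e₂ = glued _} _ r)    = ⊥-elim (⇝-stays-right tt r)
  ⇝-left-left (cons {e₂ = right _ _} () _)

  ⇝-left-glued : ∀ {e j} .{p} → left e p ⇝ glued j → e ⇝₁ o j
  ⇝-left-glued (step eq)                   = step₁ (left-injective eq)
  ⇝-left-glued (cons {e₂ = left _ _} eq r) = cons₁ (left-injective eq) (⇝-left-glued r)
  ⇝-left-glued (cons {e₂ = glued _} _ r)   = ⊥-elim (⇝-stays-right tt r)
  ⇝-left-glued (cons {e₂ = right _ _} () _)

  ⇝-right-right : ∀ {e₁ e₂} .{p q} → right e₁ p ⇝ right e₂ q → e₁ ⇝₂ e₂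
  ⇝-right-right (step eq)                    = step₂ (right-injective eq)
  ⇝-right-right (cons {e₂ = right _ _} eq r) = cons₂ (right-injective eq) (⇝-right-right r)
  ⇝-right-right (cons {e₂ = left _ _} () _)
  ⇝-right-right (cons {e₂ = glued _} () _)

  ⇝-glued-right : ∀ {j e} .{q} → glued j ⇝ right e q → i j ⇝₂ e
  ⇝-glued-right (step eq)                    = step₂ (right-injective eq)
  ⇝-glued-right (cons {e₂ = right _ _} eq r) = cons₂ (right-injective eq) (⇝-right-right r)
  ⇝-glued-right (cons {e₂ = left _ _} () _)
  ⇝-glued-right (cons {e₂ = glued _} () _)

  ⇝-left-right : ∀ {e₁ e₂} .{p q} → left e₁ p ⇝ right e₂ q →
                 Σ[ j ∈ Fin n ] (e₁ ⇝₁ o j × i j ⇝₂ e₂)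
  ⇝-left-right (step ())
  ⇝-left-right (cons {e₂ = left _ _} eq r) with ⇝-left-right r
  ... | j , e⇝o , i⇝e = j , cons₁ (left-injective eq) e⇝o , i⇝e
  ⇝-left-right (cons {e₂ = glued j} eq r)  = j , step₁ (left-injective eq) , ⇝-glued-right r
  ⇝-left-right (cons {e₂ = right _ _} () _)

  module PathOrder
      (linear₁ : IsStrictTotalOrder _≡_ _≺₁_) (linear₂ : IsStrictTotalOrder _≡_ _≺₂_)
      (pathOrder₁ : ∀ e₁ e₂ → e₁ ⇝₁ e₂ → e₁ ≺₁ e₂) (pathOrder₂ : ∀ e₁ e₂ → e₁ ⇝₂ e₂ → e₁ ≺₂ e₂)
      (en₁ : OrderedEnumeration G₁ _≺₁_ (OutputEdge G₁ σ₁) n o)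
      (en₂ : OrderedEnumeration G₂ _≺₂_ (InputEdge G₂ σ₂) n i) where
    open Slots linear₁ using () renaming (Slot to Slot₁; slot to slot₁)
    open Slots linear₂ using () renaming (Slot to Slot₂; slot to slot₂)
    open Slots using (bounded; below; above; slot-≤; slot->; slot-mono)

    left-slot : ∀ e → .(σ₁ (Graph.tgt G₁ e) ≡ false) → Σ ℕ (Slot₁ o e)
    left-slot e p = slot₁ o (proj₂ (proj₂ en₁)) e
      λ { j refl → contradiction-irr p (not-¬ (proj₁ en₁ j)) }

    right-slot : ∀ e → .(σ₂ (Graph.src G₂ e) ≡ false) → Σ ℕ (Slot₂ i e)
    right-slot e p = slot₂ i (proj₂ (proj₂ en₂)) e
      λ { j refl → contradiction-irr p (not-¬ (proj₁ en₂ j)) }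

    Q-block : ∀ {e a} .{p} → Slot₁ o e a → InBlock (left e p) (suc (3 * a))
    Q-block s = inQ _ (bounded s) (below s) (above s)

    P-block : ∀ {e a} .{p} → Slot₂ i e a → InBlock (right e p) (3 * a)
    P-block s = inP _ (bounded s) (below s) (above s)

    ≺-across : ∀ {x y b b'} → InBlock x b → InBlock y b' → b < b' → x ≺ y
    ≺-across x∈b y∈b' b<b' = _ , _ , x∈b , y∈b' , inj₁ b<b'

    ≺-inside : ∀ {x y b} → InBlock x b → InBlock y b → WithinBlock x y → x ≺ y
    ≺-inside x∈b y∈b x≺y = _ , _ , x∈b , y∈b , inj₂ (refl , x≺y)

    ≺-left-left : ∀ {e₁ e₂} .{p q} → Σ ℕ (Slot₁ o e₁) → Σ ℕ (Slot₁ o e₂) →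
                  e₁ ≺₁ e₂ → left e₁ p ≺ left e₂ q
    ≺-left-left (a₁ , s₁) (a₂ , s₂) e₁≺e₂ with m≤n⇒m<n∨m≡n (slot-mono linear₁ s₁ s₂ e₁≺e₂)
    ... | inj₁ a₁<a₂ = ≺-across (Q-block s₁) (Q-block s₂) (s≤s (<⇒≤ (<⇒≤ (m<n⇒3m+3≤3n a₁<a₂))))
    ... | inj₂ refl  = ≺-inside (Q-block s₁) (Q-block s₂) e₁≺e₂

    ≺-right-right : ∀ {e₁ e₂} .{p q} → Σ ℕ (Slot₂ i e₁) → Σ ℕ (Slot₂ i e₂) →
                    e₁ ≺₂ e₂ → right e₁ p ≺ right e₂ q
    ≺-right-right (a₁ , s₁) (a₂ , s₂) e₁≺e₂ with m≤n⇒m<n∨m≡n (slot-mono linear₂ s₁ s₂ e₁≺e₂)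
    ... | inj₁ a₁<a₂ = ≺-across (P-block s₁) (P-block s₂) (<⇒≤ (<⇒≤ (m<n⇒3m+3≤3n a₁<a₂)))
    ... | inj₂ refl  = ≺-inside (P-block s₁) (P-block s₂) e₁≺e₂

    ≺-left-glued : ∀ {e j} .{p} → Σ ℕ (Slot₁ o e) → e ≺₁ o j → left e p ≺ glued j
    ≺-left-glued {j = j} (a , s) e≺oj =
      ≺-across (Q-block s) (inE j) (s≤s (s≤s (*-monoʳ-≤ 3 (slot-≤ linear₁ s e≺oj))))

    ≺-glued-right : ∀ {j e} .{q} → Σ ℕ (Slot₂ i e) → i j ≺₂ e → glued j ≺ right e q
    ≺-glued-right {j = j} (a , s) ij≺e =
      ≺-across (inE j) (P-block s) (m<n⇒3m+3≤3n (slot-> linear₂ s ij≺e))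

    ≺-left-right : ∀ {e₁ e₂ j} .{p q} → Σ ℕ (Slot₁ o e₁) → Σ ℕ (Slot₂ i e₂) →
                   e₁ ≺₁ o j → i j ≺₂ e₂ → left e₁ p ≺ right e₂ q
    ≺-left-right (a₁ , s₁) (a₂ , s₂) e₁≺oj ij≺e₂ =
      ≺-across (Q-block s₁) (P-block s₂)
        (<⇒≤ (m<n⇒3m+3≤3n (≤-trans (s≤s (slot-≤ linear₁ s₁ e₁≺oj)) (slot-> linear₂ s₂ ij≺e₂))))

    ⇝⇒≺ : ∀ x y → x ⇝ y → x ≺ y
    ⇝⇒≺ (left e₁ p)  (left e₂ q)  r =
      ≺-left-left (left-slot e₁ p) (left-slot e₂ q) (pathOrder₁ _ _ (⇝-left-left r))
    ⇝⇒≺ (left e p)   (glued j)    r = ≺-left-glued (left-slot e p) (pathOrder₁ _ _ (⇝-left-glued r))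
    ⇝⇒≺ (left e₁ p)  (right e₂ q) r with ⇝-left-right r
    ... | j , e₁⇝oj , ij⇝e₂ =
      ≺-left-right (left-slot e₁ p) (right-slot e₂ q) (pathOrder₁ _ _ e₁⇝oj) (pathOrder₂ _ _ ij⇝e₂)
    ⇝⇒≺ (glued j)    (right e q)  r = ≺-glued-right (right-slot e q) (pathOrder₂ _ _ (⇝-glued-right r))
    ⇝⇒≺ (right e₁ p) (right e₂ q) r =
      ≺-right-right (right-slot e₁ p) (right-slot e₂ q) (pathOrder₂ _ _ (⇝-right-right r))
    ⇝⇒≺ (glued _)    (left _ _)   r = ⊥-elim (⇝-stays-right tt r)
    ⇝⇒≺ (glued _)    (glued _)    r = ⊥-elim (⇝-stays-right tt r)
    ⇝⇒≺ (right _ _)  (left _ _)   r = ⊥-elim (⇝-stays-right tt r)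
    ⇝⇒≺ (right _ _)  (glued _)    r = ⊥-elim (⇝-stays-right tt r)

proposition5p1 : (G₁ G₂ : Graph) (σ₁ : Graph.V G₁ → Bool) (σ₂ : Graph.V G₂ → Bool)
    (_≺₁_ : Graph.E G₁ → Graph.E G₁ → Set) (_≺₂_ : Graph.E G₂ → Graph.E G₂ → Set) →
    AdmUPO G₁ σ₁ _≺₁_ → AdmUPO G₂ σ₂ _≺₂_ →
    (n : ℕ) (o : Fin n → Graph.E G₁) (i : Fin n → Graph.E G₂) →
    OrderedEnumeration G₁ _≺₁_ (OutputEdge G₁ σ₁) n o →
    OrderedEnumeration G₂ _≺₂_ (InputEdge G₂ σ₂) n i →
    let open Composition G₁ G₂ σ₁ σ₂ _≺₁_ _≺₂_ n o i in
    ∀ e₁ e₂ → GraphNotions._⇝_ G e₁ e₂ → e₁ ≺ e₂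
proposition5p1 G₁ G₂ σ₁ σ₂ _≺₁_ _≺₂_ A₁ A₂ n o i en₁ en₂ =
  Composite.PathOrder.⇝⇒≺ G₁ G₂ σ₁ σ₂ _≺₁_ _≺₂_ n o i
    (IsUPO.linear U₁) (IsUPO.linear U₂) (IsUPO.pathOrder U₁) (IsUPO.pathOrder U₂) en₁ en₂
  where
  U₁ : IsUPO G₁ _≺₁_
  U₁ = AdmUPO.upo A₁
  U₂ : IsUPO G₂ _≺₂_
  U₂ = AdmUPO.upo A₂
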